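{- Let $f$ be a frequency distribution on $[n]$ (positive entries) and let $(U,\overline U)$ be a partition of $[n]$ into two sets. Consider the following procedure: (1) draw a random permutation $\pi$ of $U$ by sampling without replacement from $f$ restricted to $U$; (2) independently draw a random permutation $\overline\pi$ of $\overline U$ by sampling without replacement from $f$ restricted to $\overline U$; (3) for $j=1,2,\dots,n$, letting $f(\pi)$ and $f(\overline\pi)$ denote the sums of frequencies of the items currently remaining in $\pi$ and $\overline\pi$ respectively, with probability $f(\pi)/(f(\pi)+f(\overline\pi))$ set $i_j$ to be the first remaining item of $\pi$ and delete it from $\pi$, and otherwise set $i_j$ to be the first remaining item of $\overline\pi$ and delete it from $\overline\pi$. Then the resulting random permutation $i_1,\dots,i_n$ of $[n]$ has the same distribution as a permutation obtained by sampling without replacement from $f$.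
   Context: Sampling without replacement from a frequency distribution $f$ on a finite set $S$: the first element is chosen with probability proportional to $f$, and each subsequent element is chosen from the remaining elements with probability proportional to $f$ restricted to them.
   Formalization: The frequency distribution f has positive rational entries. -}

module Defs where

open import Data.Nat using (ℕ; zero; suc)
open import Data.Fin using (Fin)
open import Data.Fin.Subset using (Subset; _∈_; _-_; ∣_∣)
open import Data.Fin.Subset.Properties using (_∈?_)
open import Data.Fin.Properties using () renaming (_≟_ to _≟ᶠ_)
open import Data.List using (List; []; _∷_; map; concatMap; allFin; filter; foldr)
open import Data.Rational using (ℚ; 0ℚ; 1ℚ; _+_; _*_; 1/_; _≟_; ≢-nonZero)
open import Relation.Nullary using (yes; no)

-- Total division on ℚ (x ÷ 0 := 0); only ever applied with positive denominators
-- in meaningful situations.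
_÷'_ : ℚ → ℚ → ℚ
p ÷' q with q ≟ 0ℚ
... | yes _  = 0ℚ
... | no q≢0 = p * (1/_ q {{≢-nonZero q≢0}})

sumℚ : List ℚ → ℚ
sumℚ = foldr _+_ 0ℚ

module _ {n : ℕ} (f : Fin n → ℚ) where

  fSet : Subset n → ℚ
  fSet S = sumℚ (map f (filter (_∈? S) (allFin n)))

  fList : List (Fin n) → ℚ
  fList xs = sumℚ (map f xs)

  -- Probability that sampling without replacement from f restricted to S
  -- produces exactly the sequence σ: the first element is drawn from S with
  -- probability proportional to f, then the rest from S minus it, until S is
  -- exhausted.
  pSWOR : Subset n → List (Fin n) → ℚ
  pSWOR S [] with ∣ S ∣
  ... | zero  = 1ℚ
  ... | suc _ = 0ℚ
  pSWOR S (i ∷ σ) with i ∈? S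
  ... | yes _ = (f i ÷' fSet S) * pSWOR (S - i) σ
  ... | no  _ = 0ℚ

  -- Probability that the merge step (3), started with remaining sequences
  -- π and π̄, outputs exactly the sequence out.
  pMerge : List (Fin n) → List (Fin n) → List (Fin n) → ℚ
  pMerge [] [] [] = 1ℚ
  pMerge π π̄ [] = 0ℚ
  pMerge π π̄ (i ∷ out) = left π + right π̄
    where
      tot : ℚ
      tot = fList π + fList π̄
      left : List (Fin n) → ℚ
      left [] = 0ℚ
      left (j ∷ π') with j ≟ᶠ i
      ... | yes _ = (fList π ÷' tot) * pMerge π' π̄ out
      ... | no  _ = 0ℚ
      right : List (Fin n) → ℚ
      right [] = 0ℚ
      right (j ∷ π̄') with j ≟ᶠ i
      ... | yes _ = (fList π̄ ÷' tot) * pMerge π π̄' out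
      ... | no  _ = 0ℚ

-- All lists of length k with entries in Fin n (a finite outcome space
-- containing every ordering of every k-element subset).
listsOfLength : (n k : ℕ) → List (List (Fin n))
listsOfLength n zero    = [] ∷ []
listsOfLength n (suc k) = concatMap (λ i → map (i ∷_) (listsOfLength n k)) (allFin n)

module _ {n : ℕ} (f : Fin n → ℚ) (U Ū : Subset n) where

  -- Probability that the two-stage procedure (1)-(3) outputs σ:
  -- sum over all outcomes π of (1) and π̄ of (2) (drawn independently).
  pProcedure : List (Fin n) → ℚ
  pProcedure σ =
    sumℚ (concatMap
      (λ π → map (λ π̄ → pSWOR f U π * pSWOR f Ū π̄ * pMerge f π π̄ σ)
                 (listsOfLength n ∣ Ū ∣))
      (listsOfLength n ∣ U ∣))

-- Generalise from the partition (U, ∁ U) to an arbitrary pair of disjoint sets A, B and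
-- induct on the output sequence. As pMerge is symmetric in its two inputs, the probability
-- of outputting i ∷ σ is the probability that i is taken from the first input plus the same
-- with A and B swapped, and only the term for the side containing i survives. On the support
-- of sampling without replacement from A the items still in π weigh f(A) in total, so i is
-- taken from π with probability (f(A) / (f(A) + f(B))) · (f i / f(A)) = f i / f(A ∪ B), after
-- which the same procedure runs on (A − i, B): this is the recursion that defines sampling
-- without replacement from A ∪ B.

module Submission where

open import Defs
open import Data.Nat as ℕ using (ℕ; zero; suc)
import Data.Nat.Properties as ℕ
open import Data.Fin using (Fin; zero; suc)
open import Data.Fin.Properties using (suc-injective) renaming (_≟_ to _≟ᶠ_)
open import Data.Fin.Subset using (Subset; Side; ∁; ⊤; _∈_; _∉_; _∪_; _-_; ∣_∣; inside; outside; ⁅_⁆)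
open import Data.Fin.Subset.Properties
  using (_∈?_; p─⊥≡p; x∈p∪q⁺; x∈p∪q⁻; p─q⊆p; p∪∁p≡⊤; x∈p⇒x∉∁p; ∪-comm)
open import Data.Vec using ([]; _∷_; here; there)
open import Data.List using (List; []; _∷_; map; concatMap; allFin; filter; tabulate; _++_)
open import Data.List.Properties using (map-tabulate; map-concatMap; map-∘)
open import Data.Rational using (ℚ; 0ℚ; 1ℚ; _+_; _*_; _<_; _≤_; 1/_; _≟_; ≢-nonZero)
open import Data.Rational.Properties
  using (+-identityˡ; +-identityʳ; +-assoc; +-comm; *-zeroˡ; *-zeroʳ; *-identityʳ; *-distribˡ-+;
         *-inverseˡ; ≤-refl; <⇒≤; <⇒≢; +-mono-≤; +-mono-<-≤)
open import Data.Rational.Solver using (module +-*-Solver)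
open import Data.Sum using (_⊎_; inj₁; inj₂)
open import Data.Empty using (⊥-elim)
open import Function using (_∘_; id)
open import Relation.Nullary using (Dec; yes; no)
open import Relation.Binary.PropositionalEquality
open ≡-Reasoning
open +-*-Solver using (solve; _:=_; _:*_; _:+_)

module _ {A : Set} where

  sumOver : List A → (A → ℚ) → ℚ
  sumOver xs g = sumℚ (map g xs)

  infix 5 sumOver
  syntax sumOver xs (λ x → e) = ∑[ x ← xs ] e

sumℚ-++ : (xs ys : List ℚ) → sumℚ (xs ++ ys) ≡ sumℚ xs + sumℚ ys
sumℚ-++ []       ys = sym (+-identityˡ _)
sumℚ-++ (x ∷ xs) ys = trans (cong (x +_) (sumℚ-++ xs ys)) (sym (+-assoc x _ _))

module _ {A : Set} where

  sumℚ-concatMap : (h : A → List ℚ) (xs : List A) → sumℚ (concatMap h xs) ≡ ∑[ x ← xs ] sumℚ (h x)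
  sumℚ-concatMap h []       = refl
  sumℚ-concatMap h (x ∷ xs) =
    trans (sumℚ-++ (h x) (concatMap h xs)) (cong (sumℚ (h x) +_) (sumℚ-concatMap h xs))

  ∑-cong : {g h : A → ℚ} → (∀ x → g x ≡ h x) → (xs : List A) → sumOver xs g ≡ sumOver xs h
  ∑-cong g≡h []       = refl
  ∑-cong g≡h (x ∷ xs) = cong₂ _+_ (g≡h x) (∑-cong g≡h xs)

  ∑-zero : {g : A → ℚ} → (∀ x → g x ≡ 0ℚ) → (xs : List A) → sumOver xs g ≡ 0ℚ
  ∑-zero g≡0 []       = refl
  ∑-zero g≡0 (x ∷ xs) = trans (cong₂ _+_ (g≡0 x) (∑-zero g≡0 xs)) (+-identityˡ 0ℚ)

  ∑-*ˡ : (c : ℚ) (g : A → ℚ) (xs : List A) → (∑[ x ← xs ] c * g x) ≡ c * sumOver xs g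
  ∑-*ˡ c g []       = sym (*-zeroʳ c)
  ∑-*ˡ c g (x ∷ xs) = trans (cong (c * g x +_) (∑-*ˡ c g xs)) (sym (*-distribˡ-+ c (g x) _))

  ∑-+ : (g h : A → ℚ) (xs : List A) → (∑[ x ← xs ] g x + h x) ≡ sumOver xs g + sumOver xs h
  ∑-+ g h []       = sym (+-identityˡ 0ℚ)
  ∑-+ g h (x ∷ xs) = begin
    g x + h x + (∑[ y ← xs ] g y + h y)       ≡⟨ cong (g x + h x +_) (∑-+ g h xs) ⟩
    g x + h x + (sumOver xs g + sumOver xs h) ≡⟨ solve 4 (λ a b c d → a :+ b :+ (c :+ d) := a :+ c :+ (b :+ d))
                                                   refl (g x) (h x) (sumOver xs g) (sumOver xs h) ⟩
    g x + sumOver xs g + (h x + sumOver xs h) ∎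

module _ {A B : Set} where

  ∑-concatMap : (h : A → List B) (g : B → ℚ) (xs : List A) →
                sumOver (concatMap h xs) g ≡ ∑[ x ← xs ] sumOver (h x) g
  ∑-concatMap h g xs = trans (cong sumℚ (map-concatMap g h xs)) (sumℚ-concatMap (map g ∘ h) xs)

  ∑-comm : (g : A → B → ℚ) (xs : List A) (ys : List B) →
           (∑[ x ← xs ] ∑[ y ← ys ] g x y) ≡ (∑[ y ← ys ] ∑[ x ← xs ] g x y)
  ∑-comm g []       ys = sym (∑-zero (λ _ → refl) ys)
  ∑-comm g (x ∷ xs) ys = begin
    (∑[ y ← ys ] g x y) + (∑[ x′ ← xs ] ∑[ y ← ys ] g x′ y)
      ≡⟨ cong (sumOver ys (g x) +_) (∑-comm g xs ys) ⟩
    (∑[ y ← ys ] g x y) + (∑[ y ← ys ] ∑[ x′ ← xs ] g x′ y)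
      ≡⟨ sym (∑-+ (g x) (λ y → ∑[ x′ ← xs ] g x′ y) ys) ⟩
    (∑[ y ← ys ] g x y + (∑[ x′ ← xs ] g x′ y))
      ∎

∑-allFin-suc : ∀ {m} (F : Fin (suc m) → ℚ) → sumOver (allFin (suc m)) F ≡ F zero + sumOver (allFin m) (F ∘ suc)
∑-allFin-suc {m} F = cong (F zero +_) (cong sumℚ (trans (map-tabulate suc F) (sym (map-tabulate id (F ∘ suc)))))

∑-allFin-single : ∀ {m} (F : Fin m → ℚ) (i : Fin m) → (∀ j → j ≢ i → F j ≡ 0ℚ) →
                  sumOver (allFin m) F ≡ F i
∑-allFin-single {suc m} F zero    F≡0 = begin
  sumOver (allFin (suc m)) F              ≡⟨ ∑-allFin-suc F ⟩
  F zero + sumOver (allFin m) (F ∘ suc)  ≡⟨ cong (F zero +_) (∑-zero (λ j → F≡0 (suc j) (λ ())) (allFin m)) ⟩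
  F zero + 0ℚ                            ≡⟨ +-identityʳ _ ⟩
  F zero                                 ∎
∑-allFin-single {suc m} F (suc i) F≡0 = begin
  sumOver (allFin (suc m)) F              ≡⟨ ∑-allFin-suc F ⟩
  F zero + sumOver (allFin m) (F ∘ suc)  ≡⟨ cong₂ _+_ (F≡0 zero (λ ())) (∑-allFin-single (F ∘ suc) i F∘suc≡0) ⟩
  0ℚ + F (suc i)                         ≡⟨ +-identityˡ _ ⟩
  F (suc i)                              ∎
  where
  F∘suc≡0 : ∀ j → j ≢ i → F (suc j) ≡ 0ℚ
  F∘suc≡0 j j≢i = F≡0 (suc j) (j≢i ∘ suc-injective)

module _ {n : ℕ} where

  ∑-listsOfLength-suc : (g : List (Fin n) → ℚ) (k : ℕ) →
    sumOver (listsOfLength n (suc k)) g ≡ ∑[ j ← allFin n ] ∑[ π ← listsOfLength n k ] g (j ∷ π)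
  ∑-listsOfLength-suc g k =
    trans (∑-concatMap (λ j → map (j ∷_) (listsOfLength n k)) g (allFin n))
          (∑-cong (λ j → cong sumℚ (sym (map-∘ (listsOfLength n k)))) (allFin n))

  ∑-listsOfLength-zero : (g : List (Fin n) → ℚ) {k : ℕ} → k ≡ 0 → sumOver (listsOfLength n k) g ≡ g []
  ∑-listsOfLength-zero g refl = +-identityʳ (g [])

  ∑-listsOfLength-head : (g : List (Fin n) → ℚ) (i : Fin n) {k k′ : ℕ} → k ≡ suc k′ →
    (∀ j π → j ≢ i → g (j ∷ π) ≡ 0ℚ) →
    sumOver (listsOfLength n k) g ≡ ∑[ π ← listsOfLength n k′ ] g (i ∷ π)
  ∑-listsOfLength-head g i {k′ = k′} refl g≡0 =
    trans (∑-listsOfLength-suc g k′)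
          (∑-allFin-single _ i (λ j j≢i → ∑-zero (λ π → g≡0 j π j≢i) (listsOfLength n k′)))

  ∑-listsOfLength-cons-zero : (g : List (Fin n) → ℚ) {k k′ : ℕ} → k ≡ suc k′ →
    (∀ j π → g (j ∷ π) ≡ 0ℚ) → sumOver (listsOfLength n k) g ≡ 0ℚ
  ∑-listsOfLength-cons-zero g {k′ = k′} refl g≡0 =
    trans (∑-listsOfLength-suc g k′)
          (∑-zero (λ j → ∑-zero (g≡0 j) (listsOfLength n k′)) (allFin n))

Disjoint : ∀ {m} → Subset m → Subset m → Set
Disjoint A B = ∀ {x} → x ∈ A → x ∉ B

module _ {m : ℕ} where

  Disjoint-sym : {A B : Subset m} → Disjoint A B → Disjoint B A
  Disjoint-sym d x∈B x∈A = d x∈A x∈B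

  Disjoint-drop : ∀ {s t} {A B : Subset m} → Disjoint (s ∷ A) (t ∷ B) → Disjoint A B
  Disjoint-drop d x∈A x∈B = d (there x∈A) (there x∈B)

  Disjoint-remove : {A B : Subset m} (i : Fin m) → Disjoint A B → Disjoint (A - i) B
  Disjoint-remove {A} i d x∈A-i = d (p─q⊆p A ⁅ i ⁆ x∈A-i)

∣p∣≡1+∣p-x∣ : ∀ {m} {x : Fin m} (p : Subset m) → x ∈ p → ∣ p ∣ ≡ suc ∣ p - x ∣
∣p∣≡1+∣p-x∣ (inside  ∷ p) here      = cong (suc ∘ ∣_∣) (sym (p─⊥≡p p))
∣p∣≡1+∣p-x∣ (inside  ∷ p) (there x∈p) = cong suc (∣p∣≡1+∣p-x∣ p x∈p)
∣p∣≡1+∣p-x∣ (outside ∷ p) (there x∈p) = ∣p∣≡1+∣p-x∣ p x∈p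

∣p∪q∣≡∣p∣+∣q∣ : ∀ {m} (p q : Subset m) → Disjoint p q → ∣ p ∪ q ∣ ≡ ∣ p ∣ ℕ.+ ∣ q ∣
∣p∪q∣≡∣p∣+∣q∣ []            []            d = refl
∣p∪q∣≡∣p∣+∣q∣ (inside  ∷ p) (inside  ∷ q) d = ⊥-elim (d here here)
∣p∪q∣≡∣p∣+∣q∣ (inside  ∷ p) (outside ∷ q) d = cong suc (∣p∪q∣≡∣p∣+∣q∣ p q (Disjoint-drop d))
∣p∪q∣≡∣p∣+∣q∣ (outside ∷ p) (inside  ∷ q) d =
  trans (cong suc (∣p∪q∣≡∣p∣+∣q∣ p q (Disjoint-drop d))) (sym (ℕ.+-suc ∣ p ∣ ∣ q ∣))
∣p∪q∣≡∣p∣+∣q∣ (outside ∷ p) (outside ∷ q) d = ∣p∪q∣≡∣p∣+∣q∣ p q (Disjoint-drop d)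

p-x∪q≡p∪q-x : ∀ {m} (p q : Subset m) {x : Fin m} → x ∉ q → (p - x) ∪ q ≡ (p ∪ q) - x
p-x∪q≡p∪q-x (s ∷ p) (inside  ∷ q) {zero}  x∉q = ⊥-elim (x∉q here)
p-x∪q≡p∪q-x (s ∷ p) (outside ∷ q) {zero}  x∉q =
  cong (outside ∷_) (trans (cong (_∪ q) (p─⊥≡p p)) (sym (p─⊥≡p (p ∪ q))))
p-x∪q≡p∪q-x (s ∷ p) (t ∷ q)       {suc x} x∉q = cong (_ ∷_) (p-x∪q≡p∪q-x p q (x∉q ∘ there))

subsetSum : ∀ {m} → (Fin m → ℚ) → Subset m → ℚ
subsetSum g []            = 0ℚ
subsetSum g (inside  ∷ S) = g zero + subsetSum (g ∘ suc) S
subsetSum g (outside ∷ S) = subsetSum (g ∘ suc) S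

-- `tabulate suc` is the tail of `allFin (suc m)`.
fSet-tail : ∀ {m} (g : Fin (suc m) → ℚ) (s : Side) (S : Subset m) →
            sumOver (filter (_∈? s ∷ S) (tabulate suc)) g ≡ fSet (g ∘ suc) S
fSet-tail {m} g s S =
  trans (cong (λ xs → sumOver (filter (_∈? s ∷ S) xs) g) (sym (map-tabulate id suc))) (filter-suc (allFin m))
  where
  filter-suc : ∀ xs → sumOver (filter (_∈? s ∷ S) (map suc xs)) g ≡ sumOver (filter (_∈? S) xs) (g ∘ suc)
  filter-suc []       = refl
  filter-suc (x ∷ xs) with x ∈? S
  ... | yes _ = cong (g (suc x) +_) (filter-suc xs)
  ... | no  _ = filter-suc xs

fSet≡subsetSum : ∀ {m} (g : Fin m → ℚ) (S : Subset m) → fSet g S ≡ subsetSum g S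
fSet≡subsetSum g []            = refl
fSet≡subsetSum g (inside  ∷ S) = cong (g zero +_) (trans (fSet-tail g inside S) (fSet≡subsetSum (g ∘ suc) S))
fSet≡subsetSum g (outside ∷ S) = trans (fSet-tail g outside S) (fSet≡subsetSum (g ∘ suc) S)

+-swap-left : (a b c : ℚ) → a + (b + c) ≡ b + (a + c)
+-swap-left = solve 3 (λ a b c → a :+ (b :+ c) := b :+ (a :+ c)) refl

subsetSum-remove : ∀ {m} (g : Fin m → ℚ) (A : Subset m) {i : Fin m} → i ∈ A →
                   subsetSum g A ≡ g i + subsetSum g (A - i)
subsetSum-remove g (inside  ∷ A) here        = cong (λ X → g zero + subsetSum (g ∘ suc) X) (sym (p─⊥≡p A))
subsetSum-remove g (inside  ∷ A) (there i∈A) =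
  trans (cong (g zero +_) (subsetSum-remove (g ∘ suc) A i∈A)) (+-swap-left (g zero) (g (suc _)) _)
subsetSum-remove g (outside ∷ A) (there i∈A) = subsetSum-remove (g ∘ suc) A i∈A

subsetSum-∪ : ∀ {m} (g : Fin m → ℚ) (A B : Subset m) → Disjoint A B →
              subsetSum g (A ∪ B) ≡ subsetSum g A + subsetSum g B
subsetSum-∪ g []            []            d = sym (+-identityˡ 0ℚ)
subsetSum-∪ g (inside  ∷ A) (inside  ∷ B) d = ⊥-elim (d here here)
subsetSum-∪ g (inside  ∷ A) (outside ∷ B) d =
  trans (cong (g zero +_) (subsetSum-∪ (g ∘ suc) A B (Disjoint-drop d))) (sym (+-assoc (g zero) _ _))
subsetSum-∪ g (outside ∷ A) (inside  ∷ B) d =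
  trans (cong (g zero +_) (subsetSum-∪ (g ∘ suc) A B (Disjoint-drop d))) (+-swap-left (g zero) (subsetSum (g ∘ suc) A) _)
subsetSum-∪ g (outside ∷ A) (outside ∷ B) d = subsetSum-∪ (g ∘ suc) A B (Disjoint-drop d)

subsetSum-empty : ∀ {m} (g : Fin m → ℚ) (A : Subset m) → ∣ A ∣ ≡ 0 → subsetSum g A ≡ 0ℚ
subsetSum-empty g []            _     = refl
subsetSum-empty g (outside ∷ A) ∣A∣≡0 = subsetSum-empty (g ∘ suc) A ∣A∣≡0

subsetSum-nonneg : ∀ {m} (g : Fin m → ℚ) → (∀ i → 0ℚ ≤ g i) → (A : Subset m) → 0ℚ ≤ subsetSum g A
subsetSum-nonneg g g≥0 []            = ≤-refl
subsetSum-nonneg g g≥0 (inside  ∷ A) = +-mono-≤ (g≥0 zero) (subsetSum-nonneg (g ∘ suc) (g≥0 ∘ suc) A)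
subsetSum-nonneg g g≥0 (outside ∷ A) = subsetSum-nonneg (g ∘ suc) (g≥0 ∘ suc) A

module _ {m : ℕ} (g : Fin m → ℚ) where

  fSet-remove : (A : Subset m) {i : Fin m} → i ∈ A → fSet g A ≡ g i + fSet g (A - i)
  fSet-remove A {i} i∈A = begin
    fSet g A                 ≡⟨ fSet≡subsetSum g A ⟩
    subsetSum g A            ≡⟨ subsetSum-remove g A i∈A ⟩
    g i + subsetSum g (A - i) ≡⟨ cong (g i +_) (sym (fSet≡subsetSum g (A - i))) ⟩
    g i + fSet g (A - i)      ∎

  fSet-∪ : (A B : Subset m) → Disjoint A B → fSet g (A ∪ B) ≡ fSet g A + fSet g B
  fSet-∪ A B d = begin
    fSet g (A ∪ B)                ≡⟨ fSet≡subsetSum g (A ∪ B) ⟩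
    subsetSum g (A ∪ B)           ≡⟨ subsetSum-∪ g A B d ⟩
    subsetSum g A + subsetSum g B ≡⟨ sym (cong₂ _+_ (fSet≡subsetSum g A) (fSet≡subsetSum g B)) ⟩
    fSet g A + fSet g B           ∎

  fSet-empty : (A : Subset m) → ∣ A ∣ ≡ 0 → fSet g A ≡ 0ℚ
  fSet-empty A ∣A∣≡0 = trans (fSet≡subsetSum g A) (subsetSum-empty g A ∣A∣≡0)

  fSet≢0 : (∀ i → 0ℚ < g i) → (A : Subset m) {i : Fin m} → i ∈ A → fSet g A ≢ 0ℚ
  fSet≢0 g>0 A {i} i∈A fA≡0 = <⇒≢ 0<fA (sym fA≡0)
    where
    0≤fA-i : 0ℚ ≤ fSet g (A - i)
    0≤fA-i = subst (0ℚ ≤_) (sym (fSet≡subsetSum g (A - i))) (subsetSum-nonneg g (<⇒≤ ∘ g>0) (A - i))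
    0<fA : 0ℚ < fSet g A
    0<fA = subst (0ℚ <_) (sym (fSet-remove A i∈A)) (+-mono-<-≤ (g>0 i) 0≤fA-i)

÷'-cancel : (a b c : ℚ) → b ≢ 0ℚ → (a ÷' b) * (b ÷' c) ≡ a ÷' c
÷'-cancel a b c b≢0 with c ≟ 0ℚ
... | yes _  = *-zeroʳ (a ÷' b)
... | no c≢0 with b ≟ 0ℚ
...   | yes b≡0 = ⊥-elim (b≢0 b≡0)
...   | no b≢0′ = begin
  a * b⁻¹ * (b * c⁻¹) ≡⟨ solve 4 (λ a b⁻¹ b c⁻¹ → a :* b⁻¹ :* (b :* c⁻¹) := a :* (b⁻¹ :* b) :* c⁻¹)
                               refl a b⁻¹ b c⁻¹ ⟩
  a * (b⁻¹ * b) * c⁻¹ ≡⟨ cong (λ z → a * z * c⁻¹) (*-inverseˡ b {{≢-nonZero b≢0′}}) ⟩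
  a * 1ℚ * c⁻¹        ≡⟨ cong (_* c⁻¹) (*-identityʳ a) ⟩
  a * c⁻¹             ∎
  where
  b⁻¹ c⁻¹ : ℚ
  b⁻¹ = 1/_ b {{≢-nonZero b≢0′}}
  c⁻¹ = 1/_ c {{≢-nonZero c≢0}}

*-cong-on-support₂ : {p q x x′ y y′ : ℚ} → p ≡ 0ℚ ⊎ x ≡ y → q ≡ 0ℚ ⊎ x′ ≡ y′ →
                     (h : ℚ → ℚ → ℚ) → p * q * h x x′ ≡ p * q * h y y′
*-cong-on-support₂ {q = q} {x} {x′} {y} {y′} (inj₁ refl) _ h =
  trans (zero-left (h x x′)) (sym (zero-left (h y y′)))
  where
  zero-left : ∀ z → 0ℚ * q * z ≡ 0ℚ
  zero-left z = trans (cong (_* z) (*-zeroˡ q)) (*-zeroˡ z)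
*-cong-on-support₂ {p} {x = x} {x′} {y} {y′} (inj₂ refl) (inj₁ refl) h =
  trans (zero-right (h x x′)) (sym (zero-right (h y y′)))
  where
  zero-right : ∀ z → p * 0ℚ * z ≡ 0ℚ
  zero-right z = trans (cong (_* z) (*-zeroʳ p)) (*-zeroˡ z)
*-cong-on-support₂ (inj₂ refl) (inj₂ refl) h = refl

module _ {n : ℕ} (f : Fin n → ℚ) where

  pSWOR-[]-empty : (S : Subset n) → ∣ S ∣ ≡ 0 → pSWOR f S [] ≡ 1ℚ
  pSWOR-[]-empty S ∣S∣≡0 rewrite ∣S∣≡0 = refl

  pSWOR-[]-nonempty : (S : Subset n) {k : ℕ} → ∣ S ∣ ≡ suc k → pSWOR f S [] ≡ 0ℚ
  pSWOR-[]-nonempty S ∣S∣≡1+k rewrite ∣S∣≡1+k = refl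

  pSWOR-∷-∈ : (S : Subset n) {i : Fin n} (σ : List (Fin n)) → i ∈ S →
              pSWOR f S (i ∷ σ) ≡ (f i ÷' fSet f S) * pSWOR f (S - i) σ
  pSWOR-∷-∈ S {i} σ i∈S with i ∈? S
  ... | yes _   = refl
  ... | no  i∉S = ⊥-elim (i∉S i∈S)

  pSWOR-∷-∉ : (S : Subset n) {i : Fin n} (σ : List (Fin n)) → i ∉ S → pSWOR f S (i ∷ σ) ≡ 0ℚ
  pSWOR-∷-∉ S {i} σ i∉S with i ∈? S
  ... | yes i∈S = ⊥-elim (i∉S i∈S)
  ... | no  _   = refl

  pSWOR≡0⊎fList≡fSet : (S : Subset n) (σ : List (Fin n)) → pSWOR f S σ ≡ 0ℚ ⊎ fList f σ ≡ fSet f S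
  pSWOR≡0⊎fList≡fSet S [] with ∣ S ∣ in ∣S∣≡k
  ... | zero  = inj₂ (sym (fSet-empty f S ∣S∣≡k))
  ... | suc _ = inj₁ refl
  pSWOR≡0⊎fList≡fSet S (i ∷ σ) with i ∈? S
  ... | no  _   = inj₁ refl
  ... | yes i∈S with pSWOR≡0⊎fList≡fSet (S - i) σ
  ...   | inj₁ p≡0 = inj₁ (trans (cong ((f i ÷' fSet f S) *_) p≡0) (*-zeroʳ (f i ÷' fSet f S)))
  ...   | inj₂ eq  = inj₂ (trans (cong (f i +_) eq) (sym (fSet-remove f S i∈S)))

  -- The two summands `left` and `right` of the cons clause of pMerge.
  drawFirst : List (Fin n) → List (Fin n) → Fin n → List (Fin n) → ℚ
  drawFirst []      π̄ i σ = 0ℚ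
  drawFirst (j ∷ π) π̄ i σ with j ≟ᶠ i
  ... | yes _ = (fList f (j ∷ π) ÷' (fList f (j ∷ π) + fList f π̄)) * pMerge f π π̄ σ
  ... | no  _ = 0ℚ

  drawSecond : List (Fin n) → List (Fin n) → Fin n → List (Fin n) → ℚ
  drawSecond π []      i σ = 0ℚ
  drawSecond π (j ∷ π̄) i σ with j ≟ᶠ i
  ... | yes _ = (fList f (j ∷ π̄) ÷' (fList f π + fList f (j ∷ π̄))) * pMerge f π π̄ σ
  ... | no  _ = 0ℚ

  pMerge-∷ : ∀ π π̄ i σ → pMerge f π π̄ (i ∷ σ) ≡ drawFirst π π̄ i σ + drawSecond π π̄ i σ
  pMerge-∷ []      []      i σ = refl
  pMerge-∷ []      (k ∷ _) i σ with k ≟ᶠ i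
  ... | yes _ = refl
  ... | no  _ = refl
  pMerge-∷ (j ∷ _) []      i σ with j ≟ᶠ i
  ... | yes _ = refl
  ... | no  _ = refl
  pMerge-∷ (j ∷ _) (k ∷ _) i σ with j ≟ᶠ i | k ≟ᶠ i
  ... | yes _ | yes _ = refl
  ... | yes _ | no  _ = refl
  ... | no  _ | yes _ = refl
  ... | no  _ | no  _ = refl

  drawSecond≡drawFirst-swap : ∀ {σ} → (∀ π π̄ → pMerge f π π̄ σ ≡ pMerge f π̄ π σ) →
                              ∀ π π̄ i → drawSecond π π̄ i σ ≡ drawFirst π̄ π i σ
  drawSecond≡drawFirst-swap comm π []      i = refl
  drawSecond≡drawFirst-swap comm π (j ∷ π̄) i with j ≟ᶠ i
  ... | yes _ = cong₂ (λ t m → (fList f (j ∷ π̄) ÷' t) * m) (+-comm (fList f π) _) (comm π π̄)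
  ... | no  _ = refl

  pMerge-comm : ∀ σ π π̄ → pMerge f π π̄ σ ≡ pMerge f π̄ π σ
  pMerge-comm []      []      []      = refl
  pMerge-comm []      []      (_ ∷ _) = refl
  pMerge-comm []      (_ ∷ _) []      = refl
  pMerge-comm []      (_ ∷ _) (_ ∷ _) = refl
  pMerge-comm (i ∷ σ) π π̄ = begin
    pMerge f π π̄ (i ∷ σ)                      ≡⟨ pMerge-∷ π π̄ i σ ⟩
    drawFirst π π̄ i σ + drawSecond π π̄ i σ   ≡⟨ +-comm (drawFirst π π̄ i σ) _ ⟩
    drawSecond π π̄ i σ + drawFirst π π̄ i σ   ≡⟨ cong₂ _+_ (swap π π̄) (sym (swap π̄ π)) ⟩
    drawFirst π̄ π i σ + drawSecond π̄ π i σ   ≡⟨ sym (pMerge-∷ π̄ π i σ) ⟩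
    pMerge f π̄ π (i ∷ σ)                      ∎
    where
    swap : ∀ π π̄ → drawSecond π π̄ i σ ≡ drawFirst π̄ π i σ
    swap π π̄ = drawSecond≡drawFirst-swap (pMerge-comm σ) π π̄ i

  pMerge-∷-drawFirst : ∀ π π̄ i σ → pMerge f π π̄ (i ∷ σ) ≡ drawFirst π π̄ i σ + drawFirst π̄ π i σ
  pMerge-∷-drawFirst π π̄ i σ =
    trans (pMerge-∷ π π̄ i σ) (cong (drawFirst π π̄ i σ +_) (drawSecond≡drawFirst-swap (pMerge-comm σ) π π̄ i))

  drawFirst-≢ : ∀ {j} π π̄ {i} σ → j ≢ i → drawFirst (j ∷ π) π̄ i σ ≡ 0ℚ
  drawFirst-≢ {j} π π̄ {i} σ j≢i with j ≟ᶠ i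
  ... | yes j≡i = ⊥-elim (j≢i j≡i)
  ... | no  _   = refl

  drawFirst-≡ : ∀ π π̄ i σ →
    drawFirst (i ∷ π) π̄ i σ ≡ (fList f (i ∷ π) ÷' (fList f (i ∷ π) + fList f π̄)) * pMerge f π π̄ σ
  drawFirst-≡ π π̄ i σ with i ≟ᶠ i
  ... | yes _   = refl
  ... | no  i≢i = ⊥-elim (i≢i refl)

  pSWOR*drawFirst≡0 : (A : Subset n) {i : Fin n} → i ∉ A → ∀ π π̄ σ →
                      pSWOR f A π * drawFirst π π̄ i σ ≡ 0ℚ
  pSWOR*drawFirst≡0 A i∉A []      π̄ σ = *-zeroʳ (pSWOR f A [])
  pSWOR*drawFirst≡0 A {i} i∉A (j ∷ π) π̄ σ = by-cases (j ≟ᶠ i)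
    where
    by-cases : Dec (j ≡ i) → pSWOR f A (j ∷ π) * drawFirst (j ∷ π) π̄ i σ ≡ 0ℚ
    by-cases (yes refl) =
      trans (cong (_* drawFirst (j ∷ π) π̄ j σ) (pSWOR-∷-∉ A π i∉A)) (*-zeroˡ (drawFirst (j ∷ π) π̄ j σ))
    by-cases (no  j≢i)  =
      trans (cong (pSWOR f A (j ∷ π) *_) (drawFirst-≢ π π̄ σ j≢i)) (*-zeroʳ (pSWOR f A (j ∷ π)))

  pProcedure-nested : ∀ A B σ →
    pProcedure f A B σ ≡ ∑[ π ← listsOfLength n ∣ A ∣ ] ∑[ π̄ ← listsOfLength n ∣ B ∣ ]
                           pSWOR f A π * pSWOR f B π̄ * pMerge f π π̄ σ
  pProcedure-nested A B σ = sumℚ-concatMap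
    (λ π → map (λ π̄ → pSWOR f A π * pSWOR f B π̄ * pMerge f π π̄ σ) (listsOfLength n ∣ B ∣))
    (listsOfLength n ∣ A ∣)

  firstSum : Subset n → Subset n → Fin n → List (Fin n) → ℚ
  firstSum A B i σ = ∑[ π ← listsOfLength n ∣ A ∣ ] ∑[ π̄ ← listsOfLength n ∣ B ∣ ]
                       pSWOR f A π * pSWOR f B π̄ * drawFirst π π̄ i σ

  pProcedure-∷ : ∀ A B i σ → pProcedure f A B (i ∷ σ) ≡ firstSum A B i σ + firstSum B A i σ
  pProcedure-∷ A B i σ = begin
    pProcedure f A B (i ∷ σ)
      ≡⟨ pProcedure-nested A B (i ∷ σ) ⟩
    (∑[ π ← LA ] ∑[ π̄ ← LB ] pSWOR f A π * pSWOR f B π̄ * pMerge f π π̄ (i ∷ σ))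
      ≡⟨ ∑-cong (λ π → ∑-cong (split π) LB) LA ⟩
    (∑[ π ← LA ] ∑[ π̄ ← LB ] fromA π π̄ + fromB π̄ π)
      ≡⟨ ∑-cong (λ π → ∑-+ (fromA π) (λ π̄ → fromB π̄ π) LB) LA ⟩
    (∑[ π ← LA ] (∑[ π̄ ← LB ] fromA π π̄) + (∑[ π̄ ← LB ] fromB π̄ π))
      ≡⟨ ∑-+ _ _ LA ⟩
    firstSum A B i σ + (∑[ π ← LA ] ∑[ π̄ ← LB ] fromB π̄ π)
      ≡⟨ cong (firstSum A B i σ +_) (∑-comm (λ π π̄ → fromB π̄ π) LA LB) ⟩
    firstSum A B i σ + firstSum B A i σ
      ∎
    where
    LA = listsOfLength n ∣ A ∣
    LB = listsOfLength n ∣ B ∣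
    fromA : List (Fin n) → List (Fin n) → ℚ
    fromA π π̄ = pSWOR f A π * pSWOR f B π̄ * drawFirst π π̄ i σ
    fromB : List (Fin n) → List (Fin n) → ℚ
    fromB π̄ π = pSWOR f B π̄ * pSWOR f A π * drawFirst π̄ π i σ
    split : ∀ π π̄ → pSWOR f A π * pSWOR f B π̄ * pMerge f π π̄ (i ∷ σ) ≡ fromA π π̄ + fromB π̄ π
    split π π̄ = trans (cong (pSWOR f A π * pSWOR f B π̄ *_) (pMerge-∷-drawFirst π π̄ i σ))
      (solve 4 (λ a b x y → a :* b :* (x :+ y) := a :* b :* x :+ b :* a :* y) refl
             (pSWOR f A π) (pSWOR f B π̄) (drawFirst π π̄ i σ) (drawFirst π̄ π i σ))

  firstSum-∉ : ∀ A B {i} σ → i ∉ A → firstSum A B i σ ≡ 0ℚ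
  firstSum-∉ A B {i} σ i∉A =
    ∑-zero (λ π → ∑-zero (vanish π) (listsOfLength n ∣ B ∣)) (listsOfLength n ∣ A ∣)
    where
    vanish : ∀ π π̄ → pSWOR f A π * pSWOR f B π̄ * drawFirst π π̄ i σ ≡ 0ℚ
    vanish π π̄ = begin
      pSWOR f A π * pSWOR f B π̄ * drawFirst π π̄ i σ   ≡⟨ solve 3 (λ a b d → a :* b :* d := b :* (a :* d)) refl
                                                            (pSWOR f A π) (pSWOR f B π̄) (drawFirst π π̄ i σ) ⟩
      pSWOR f B π̄ * (pSWOR f A π * drawFirst π π̄ i σ) ≡⟨ cong (pSWOR f B π̄ *_) (pSWOR*drawFirst≡0 A i∉A π π̄ σ) ⟩
      pSWOR f B π̄ * 0ℚ                                 ≡⟨ *-zeroʳ (pSWOR f B π̄) ⟩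
      0ℚ                                              ∎

  pProcedure-[] : ∀ A B → Disjoint A B → pProcedure f A B [] ≡ pSWOR f (A ∪ B) []
  pProcedure-[] A B d = trans (pProcedure-nested A B []) (by-size ∣ A ∣ ∣ B ∣ refl refl)
    where
    LA = listsOfLength n ∣ A ∣
    LB = listsOfLength n ∣ B ∣
    summand : List (Fin n) → List (Fin n) → ℚ
    summand π π̄ = pSWOR f A π * pSWOR f B π̄ * pMerge f π π̄ []
    ∣A∪B∣≡ : ∀ {k l} → ∣ A ∣ ≡ k → ∣ B ∣ ≡ l → ∣ A ∪ B ∣ ≡ k ℕ.+ l
    ∣A∪B∣≡ ∣A∣≡k ∣B∣≡l = trans (∣p∪q∣≡∣p∣+∣q∣ A B d) (cong₂ ℕ._+_ ∣A∣≡k ∣B∣≡l)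
    by-size : ∀ k l → ∣ A ∣ ≡ k → ∣ B ∣ ≡ l → (∑[ π ← LA ] ∑[ π̄ ← LB ] summand π π̄) ≡ pSWOR f (A ∪ B) []
    by-size (suc _) _ ∣A∣≡k ∣B∣≡l = begin
      (∑[ π ← LA ] ∑[ π̄ ← LB ] summand π π̄) ≡⟨ ∑-listsOfLength-cons-zero (λ π → ∑[ π̄ ← LB ] summand π π̄) ∣A∣≡k
                                                 (λ j π → ∑-zero (λ π̄ → *-zeroʳ (pSWOR f A (j ∷ π) * pSWOR f B π̄)) LB) ⟩
      0ℚ                                    ≡⟨ sym (pSWOR-[]-nonempty (A ∪ B) (∣A∪B∣≡ ∣A∣≡k ∣B∣≡l)) ⟩
      pSWOR f (A ∪ B) []                    ∎
    by-size zero (suc _) ∣A∣≡0 ∣B∣≡l = begin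
      (∑[ π ← LA ] ∑[ π̄ ← LB ] summand π π̄) ≡⟨ ∑-listsOfLength-zero (λ π → ∑[ π̄ ← LB ] summand π π̄) ∣A∣≡0 ⟩
      (∑[ π̄ ← LB ] summand [] π̄)            ≡⟨ ∑-listsOfLength-cons-zero (summand []) ∣B∣≡l
                                                 (λ j π̄ → *-zeroʳ (pSWOR f A [] * pSWOR f B (j ∷ π̄))) ⟩
      0ℚ                                    ≡⟨ sym (pSWOR-[]-nonempty (A ∪ B) (∣A∪B∣≡ ∣A∣≡0 ∣B∣≡l)) ⟩
      pSWOR f (A ∪ B) []                    ∎
    by-size zero zero ∣A∣≡0 ∣B∣≡0 = begin
      (∑[ π ← LA ] ∑[ π̄ ← LB ] summand π π̄) ≡⟨ ∑-listsOfLength-zero (λ π → ∑[ π̄ ← LB ] summand π π̄) ∣A∣≡0 ⟩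
      (∑[ π̄ ← LB ] summand [] π̄)            ≡⟨ ∑-listsOfLength-zero (summand []) ∣B∣≡0 ⟩
      pSWOR f A [] * pSWOR f B [] * 1ℚ      ≡⟨ cong₂ (λ a b → a * b * 1ℚ) (pSWOR-[]-empty A ∣A∣≡0) (pSWOR-[]-empty B ∣B∣≡0) ⟩
      1ℚ                                    ≡⟨ sym (pSWOR-[]-empty (A ∪ B) (∣A∪B∣≡ ∣A∣≡0 ∣B∣≡0)) ⟩
      pSWOR f (A ∪ B) []                    ∎

  module _ (f>0 : ∀ i → 0ℚ < f i) where

    drawFirst-step : ∀ A B {i} π π̄ σ → i ∈ A → Disjoint A B →
      pSWOR f A (i ∷ π) * pSWOR f B π̄ * drawFirst (i ∷ π) π̄ i σ
        ≡ (f i ÷' fSet f (A ∪ B)) * (pSWOR f (A - i) π * pSWOR f B π̄ * pMerge f π π̄ σ)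
    drawFirst-step A B {i} π π̄ σ i∈A d = begin
      pSWOR f A (i ∷ π) * q * drawFirst (i ∷ π) π̄ i σ
        ≡⟨ cong₂ (λ a x → a * q * x) (pSWOR-∷-∈ A π i∈A) (drawFirst-≡ π π̄ i σ) ⟩
      c * p * q * (share (fList f (i ∷ π)) (fList f π̄) * m)
        ≡⟨ solve 5 (λ c p q s m → c :* p :* q :* (s :* m) := c :* (p :* q :* s) :* m) refl
                 c p q (share (fList f (i ∷ π)) (fList f π̄)) m ⟩
      c * (p * q * share (fList f (i ∷ π)) (fList f π̄)) * m
        ≡⟨ cong (λ z → c * z * m) (*-cong-on-support₂ support-A (pSWOR≡0⊎fList≡fSet B π̄) share) ⟩
      c * (p * q * share (fSet f A) (fSet f B)) * m
        ≡⟨ solve 5 (λ c p q s m → c :* (p :* q :* s) :* m := c :* s :* (p :* q :* m)) refl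
                 c p q (share (fSet f A) (fSet f B)) m ⟩
      c * share (fSet f A) (fSet f B) * (p * q * m)
        ≡⟨ cong (_* (p * q * m)) (÷'-cancel (f i) (fSet f A) (fSet f A + fSet f B) (fSet≢0 f f>0 A i∈A)) ⟩
      (f i ÷' (fSet f A + fSet f B)) * (p * q * m)
        ≡⟨ cong (λ z → (f i ÷' z) * (p * q * m)) (sym (fSet-∪ f A B d)) ⟩
      (f i ÷' fSet f (A ∪ B)) * (p * q * m)
        ∎
      where
      c = f i ÷' fSet f A
      p = pSWOR f (A - i) π
      q = pSWOR f B π̄
      m = pMerge f π π̄ σ
      share : ℚ → ℚ → ℚ
      share x y = x ÷' (x + y)
      support-A : p ≡ 0ℚ ⊎ fList f (i ∷ π) ≡ fSet f A
      support-A with pSWOR≡0⊎fList≡fSet (A - i) π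
      ... | inj₁ p≡0 = inj₁ p≡0
      ... | inj₂ eq  = inj₂ (trans (cong (f i +_) eq) (sym (fSet-remove f A i∈A)))

    firstSum-∈ : ∀ A B {i} σ → i ∈ A → Disjoint A B →
                 firstSum A B i σ ≡ (f i ÷' fSet f (A ∪ B)) * pProcedure f (A - i) B σ
    firstSum-∈ A B {i} σ i∈A d = begin
      firstSum A B i σ
        ≡⟨ ∑-listsOfLength-head (λ π → ∑[ π̄ ← LB ] summand π π̄) i (∣p∣≡1+∣p-x∣ A i∈A)
             (λ j π j≢i → ∑-zero (λ π̄ → not-drawn j≢i π π̄) LB) ⟩
      (∑[ π ← LA-i ] ∑[ π̄ ← LB ] summand (i ∷ π) π̄)
        ≡⟨ ∑-cong (λ π → trans (∑-cong (λ π̄ → drawFirst-step A B π π̄ σ i∈A d) LB) (∑-*ˡ c (rest π) LB)) LA-i ⟩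
      (∑[ π ← LA-i ] c * (∑[ π̄ ← LB ] rest π π̄))
        ≡⟨ ∑-*ˡ c (λ π → ∑[ π̄ ← LB ] rest π π̄) LA-i ⟩
      c * (∑[ π ← LA-i ] ∑[ π̄ ← LB ] rest π π̄)
        ≡⟨ cong (c *_) (sym (pProcedure-nested (A - i) B σ)) ⟩
      c * pProcedure f (A - i) B σ
        ∎
      where
      LA-i = listsOfLength n ∣ A - i ∣
      LB   = listsOfLength n ∣ B ∣
      c    = f i ÷' fSet f (A ∪ B)
      summand : List (Fin n) → List (Fin n) → ℚ
      summand π π̄ = pSWOR f A π * pSWOR f B π̄ * drawFirst π π̄ i σ
      rest : List (Fin n) → List (Fin n) → ℚ
      rest π π̄ = pSWOR f (A - i) π * pSWOR f B π̄ * pMerge f π π̄ σ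
      not-drawn : ∀ {j} → j ≢ i → ∀ π π̄ → summand (j ∷ π) π̄ ≡ 0ℚ
      not-drawn {j} j≢i π π̄ = trans (cong (pSWOR f A (j ∷ π) * pSWOR f B π̄ *_) (drawFirst-≢ π π̄ σ j≢i))
                                    (*-zeroʳ (pSWOR f A (j ∷ π) * pSWOR f B π̄))

    firstSum≡pSWOR-∷ : ∀ A B {i} σ → i ∈ A → Disjoint A B →
      (∀ A′ B′ → Disjoint A′ B′ → pProcedure f A′ B′ σ ≡ pSWOR f (A′ ∪ B′) σ) →
      firstSum A B i σ ≡ pSWOR f (A ∪ B) (i ∷ σ)
    firstSum≡pSWOR-∷ A B {i} σ i∈A d ih = begin
      firstSum A B i σ               ≡⟨ firstSum-∈ A B σ i∈A d ⟩
      c * pProcedure f (A - i) B σ   ≡⟨ cong (c *_) (ih (A - i) B (Disjoint-remove i d)) ⟩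
      c * pSWOR f ((A - i) ∪ B) σ    ≡⟨ cong (λ S → c * pSWOR f S σ) (p-x∪q≡p∪q-x A B (d i∈A)) ⟩
      c * pSWOR f ((A ∪ B) - i) σ    ≡⟨ sym (pSWOR-∷-∈ (A ∪ B) σ (x∈p∪q⁺ (inj₁ i∈A))) ⟩
      pSWOR f (A ∪ B) (i ∷ σ)        ∎
      where c = f i ÷' fSet f (A ∪ B)

    pProcedure≡pSWOR : ∀ σ A B → Disjoint A B → pProcedure f A B σ ≡ pSWOR f (A ∪ B) σ
    pProcedure≡pSWOR []      A B d = pProcedure-[] A B d
    pProcedure≡pSWOR (i ∷ σ) A B d with i ∈? A | i ∈? B
    ... | yes i∈A | _       = begin
      pProcedure f A B (i ∷ σ)             ≡⟨ pProcedure-∷ A B i σ ⟩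
      firstSum A B i σ + firstSum B A i σ  ≡⟨ cong₂ _+_ (firstSum≡pSWOR-∷ A B σ i∈A d (pProcedure≡pSWOR σ))
                                                         (firstSum-∉ B A σ (d i∈A)) ⟩
      pSWOR f (A ∪ B) (i ∷ σ) + 0ℚ        ≡⟨ +-identityʳ _ ⟩
      pSWOR f (A ∪ B) (i ∷ σ)              ∎
    ... | no i∉A  | yes i∈B = begin
      pProcedure f A B (i ∷ σ)             ≡⟨ pProcedure-∷ A B i σ ⟩
      firstSum A B i σ + firstSum B A i σ  ≡⟨ cong₂ _+_ (firstSum-∉ A B σ i∉A)
                                                 (firstSum≡pSWOR-∷ B A σ i∈B (Disjoint-sym d) (pProcedure≡pSWOR σ)) ⟩
      0ℚ + pSWOR f (B ∪ A) (i ∷ σ)        ≡⟨ +-identityˡ _ ⟩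
      pSWOR f (B ∪ A) (i ∷ σ)              ≡⟨ cong (λ S → pSWOR f S (i ∷ σ)) (∪-comm B A) ⟩
      pSWOR f (A ∪ B) (i ∷ σ)              ∎
    ... | no i∉A  | no i∉B  = begin
      pProcedure f A B (i ∷ σ)             ≡⟨ pProcedure-∷ A B i σ ⟩
      firstSum A B i σ + firstSum B A i σ  ≡⟨ cong₂ _+_ (firstSum-∉ A B σ i∉A) (firstSum-∉ B A σ i∉B) ⟩
      0ℚ + 0ℚ                             ≡⟨ +-identityˡ 0ℚ ⟩
      0ℚ                                  ≡⟨ sym (pSWOR-∷-∉ (A ∪ B) σ i∉A∪B) ⟩
      pSWOR f (A ∪ B) (i ∷ σ)              ∎
      where
      i∉A∪B : i ∉ A ∪ B
      i∉A∪B i∈A∪B with x∈p∪q⁻ A B i∈A∪B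
      ... | inj₁ i∈A = i∉A i∈A
      ... | inj₂ i∈B = i∉B i∈B

lemma4 : (n : ℕ) (f : Fin n → ℚ) → (∀ i → 0ℚ < f i) →
         (U : Subset n) → (σ : List (Fin n)) →
         pProcedure f U (∁ U) σ ≡ pSWOR f ⊤ σ
lemma4 n f f>0 U σ = begin
  pProcedure f U (∁ U) σ   ≡⟨ pProcedure≡pSWOR f f>0 σ U (∁ U) x∈p⇒x∉∁p ⟩
  pSWOR f (U ∪ ∁ U) σ      ≡⟨ cong (λ S → pSWOR f S σ) (p∪∁p≡⊤ U) ⟩
  pSWOR f ⊤ σ              ∎
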